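{- The consecutive patterns of relations $(\underline{\geq,=})$ and $(\underline{=,\geq})$ are super-strongly Wilf equivalent: for every $n\ge1$ and every $S\subseteq[n]$, the number of $e\in\mathbf{I}_n$ whose set of positions of occurrences of $(\underline{\geq,=})$ equals $S$ is the same as the number of $e\in\mathbf{I}_n$ whose set of positions of occurrences of $(\underline{=,\geq})$ equals $S$.
   Context: An inversion sequence of length $n$ is an integer sequence $e=e_1\dots e_n$ with $0\le e_i<i$ for all $i$; $\mathbf{I}_n$ is the set of these. For relations $R_1,R_2$, an occurrence of the consecutive pattern of relations $(\underline{R_1,R_2})$ in position $i$ of $e$ means $e_iR_1e_{i+1}$ and $e_{i+1}R_2e_{i+2}$. -}

module Defs where

open import Data.Nat using (ℕ; zero; suc; _≤?_; _≟_)
open import Data.Bool using (Bool; false; true; _∧_)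
open import Data.Vec using (Vec; []; _∷_; _∷ʳ_; replicate)
open import Data.List using (List; []; _∷_; map; concatMap; upTo; length; filter)
open import Data.Fin.Subset using (Subset)
open import Relation.Nullary.Decidable using (⌊_⌋)
open import Relation.Binary.PropositionalEquality using (_≡_)
import Data.Vec.Properties as VecP
import Data.Bool.Properties as BoolP

-- A sequence e = e₁ … eₙ is stored as a Vec ℕ n with head e₁.
-- Inversion sequences of length n (0 ≤ eᵢ < i), enumerated exactly once each:
-- I₀ = {ε},  I_{n+1} = { e · k | e ∈ Iₙ, 0 ≤ k < n+1 }.
invSeqs : (n : ℕ) → List (Vec ℕ n)
invSeqs zero    = [] ∷ []
invSeqs (suc n) = concatMap (λ e → map (λ k → e ∷ʳ k) (upTo (suc n))) (invSeqs n)

geq : ℕ → ℕ → Bool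
geq a b = ⌊ b ≤? a ⌋

eq : ℕ → ℕ → Bool
eq a b = ⌊ a ≟ b ⌋

-- Set of positions of occurrences of the consecutive pattern (R₁,R₂),
-- as a subset of [n]: the entry at index j : Fin n (position j+1) is true
-- iff e_{j+1} R₁ e_{j+2} and e_{j+2} R₂ e_{j+3}.
occ : (ℕ → ℕ → Bool) → (ℕ → ℕ → Bool) → {n : ℕ} → Vec ℕ n → Subset n
occ R₁ R₂ (a ∷ b ∷ c ∷ rest) = (R₁ a b ∧ R₂ b c) ∷ occ R₁ R₂ (b ∷ c ∷ rest)
occ R₁ R₂ {n} e = replicate n false

count : (ℕ → ℕ → Bool) → (ℕ → ℕ → Bool) → (n : ℕ) → Subset n → ℕ
count R₁ R₂ n S =
  length (filter (λ e → VecP.≡-dec BoolP._≟_ (occ R₁ R₂ e) S) (invSeqs n))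

module Submission where

-- Split an inversion sequence into its maximal weakly decreasing
-- runs x₀ ≥ x₁ ≥ … ≥ xₘ and record the drops dᵢ = xᵢ₋₁ - xᵢ of each run.  An
-- occurrence of (≥,=) at position i inside a run means that the drop just after
-- position i is 0, and an occurrence of (=,≥) means that the drop at position i
-- is 0.  Hence the map `rot` which, in every run, rotates the list of drops one
-- step to the left (d₁ d₂ … dₘ ↦ d₂ … dₘ d₁) turns the occurrence set of (≥,=)
-- into that of (=,≥).  It keeps the first and last entry of every run, so it
-- never raises an entry above the run's first entry and maps inversion
-- sequences to inversion sequences, and it has an explicit left inverse
-- (rotating back needs the last drop of the run, computed by `lastDrop`).

open import Defs
open import Data.Nat using (ℕ; _≥_)
open import Data.Fin.Subset using (Subset)
open import Relation.Binary.PropositionalEquality using (_≡_)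

open import Data.Nat using (zero; suc; _+_; _∸_; _≤_; _<_; _≤?_; _≟_; z≤n; s≤s)
open import Data.Nat.Properties
open import Data.Bool using (Bool; true; false; _∧_)
open import Data.Bool.Properties as BoolP using (∧-zeroʳ; ∧-identityʳ)
open import Data.Vec using (Vec; []; _∷_; _∷ʳ_; head; tail; initLast)
open import Data.Vec.Properties as VecP using (∷ʳ-injective)
open import Data.List using (List; []; _∷_; map; concatMap; upTo; length; filter; _++_; cartesianProductWith)
open import Data.List.Membership.Propositional using (_∈_; lose; find)
open import Data.List.Membership.Propositional.Properties
open import Data.List.Relation.Unary.Any using (here; there)
import Data.List.Relation.Unary.All as All
open import Data.List.Relation.Unary.AllPairs using ([]; _∷_)
open import Data.List.Relation.Unary.Unique.Propositional using (Unique)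
import Data.List.Relation.Unary.Unique.Propositional.Properties as Unique
open import Data.List.Properties using (length-map; length-++-sucʳ)
open import Data.Product using (_×_; _,_)
open import Data.Sum using (inj₁; inj₂)
open import Data.Unit using (⊤; tt)
open import Relation.Nullary using (Dec; ¬_; yes; no)
open import Relation.Nullary.Negation using (contradiction)
open import Relation.Nullary.Decidable using (⌊_⌋; ¬?; dec-true; dec-false; isYes≗does)
open import Relation.Unary using (Decidable)
open import Function using (_∘_; _⇔_; mk⇔; Equivalence)
open import Relation.Binary.PropositionalEquality using (refl; sym; trans; cong; cong₂; subst; module ≡-Reasoning)
open ≡-Reasoning

⌊⌋-true : {A : Set} (a? : Dec A) → A → ⌊ a? ⌋ ≡ true
⌊⌋-true a? a = trans (isYes≗does a?) (dec-true a? a)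

⌊⌋-false : {A : Set} (a? : Dec A) → ¬ A → ⌊ a? ⌋ ≡ false
⌊⌋-false a? ¬a = trans (isYes≗does a?) (dec-false a? ¬a)

geq-true : ∀ {a b} → b ≤ a → geq a b ≡ true
geq-true {a} {b} = ⌊⌋-true (b ≤? a)

geq-false : ∀ {a b} → ¬ b ≤ a → geq a b ≡ false
geq-false {a} {b} = ⌊⌋-false (b ≤? a)

eq-ascent : ∀ {a b} → ¬ b ≤ a → eq a b ≡ false
eq-ascent {a} {b} b≰a = ⌊⌋-false (a ≟ b) (λ a≡b → b≰a (≤-reflexive (sym a≡b)))

eq-+ : ∀ y z s → eq (y + s) (z + s) ≡ eq y z
eq-+ y z s with y ≟ z
... | yes y≡z = ⌊⌋-true ((y + s) ≟ (z + s)) (cong (_+ s) y≡z)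
... | no y≢z  = ⌊⌋-false ((y + s) ≟ (z + s)) (λ e → y≢z (+-cancelʳ-≡ s y z e))

occ-cons : ∀ (R₁ R₂ : ℕ → ℕ → Bool) {k} a (v : Vec ℕ (suc (suc k))) →
  occ R₁ R₂ (a ∷ v) ≡ (R₁ a (head v) ∧ R₂ (head v) (head (tail v))) ∷ occ R₁ R₂ v
occ-cons R₁ R₂ a (b ∷ c ∷ v) = refl

-- `rotAfter x r` is the image of the tail r of a sequence x ∷ r in which x
-- starts a run.  Inside a run with first drop s, `rotRun s y r` (the image of
-- y ∷ r) replaces each later entry z by z + s, so the drops move one step to
-- the left, and keeps the last entry of the run, which receives the drop s.

mutual
  rotAfter : {n : ℕ} → ℕ → Vec ℕ n → Vec ℕ n
  rotAfter x [] = []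
  rotAfter x (y ∷ r) with y ≤? x
  ... | yes _ = rotRun (x ∸ y) y r
  ... | no _  = y ∷ rotAfter y r

  rotRun : {n : ℕ} → ℕ → ℕ → Vec ℕ n → Vec ℕ (suc n)
  rotRun s y [] = y ∷ []
  rotRun s y (z ∷ r) with z ≤? y
  ... | yes _ = (z + s) ∷ rotRun s z r
  ... | no _  = y ∷ z ∷ rotAfter z r

rot : {n : ℕ} → Vec ℕ n → Vec ℕ n
rot [] = []
rot (x ∷ r) = x ∷ rotAfter x r

rotRun-head : {n : ℕ} (s y : ℕ) (r : Vec ℕ n) → head (rotRun s y r) ≤ y + s
rotRun-head s y [] = m≤m+n y s
rotRun-head s y (z ∷ r) with z ≤? y
... | yes z≤y = +-monoˡ-≤ s z≤y
... | no _    = m≤m+n y s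

mutual
  occ-rotAfter : {n : ℕ} (x : ℕ) (r : Vec ℕ n) →
    occ eq geq (x ∷ rotAfter x r) ≡ occ geq eq (x ∷ r)
  occ-rotAfter x [] = refl
  occ-rotAfter x (y ∷ r) with y ≤? x
  ... | yes y≤x = occ-rotRun (x ∸ y) x x y r (sym (m+[n∸m]≡n y≤x)) y≤x
  ... | no y≰x  = occ-ascent r y≰x

  -- At an ascent x < y neither pattern occurs.
  occ-ascent : {n x y : ℕ} (r : Vec ℕ n) → ¬ y ≤ x →
    occ eq geq (x ∷ y ∷ rotAfter y r) ≡ occ geq eq (x ∷ y ∷ r)
  occ-ascent [] _ = refl
  occ-ascent {x = x} {y} (z ∷ r) y≰x =
    trans (occ-cons eq geq x (y ∷ rotAfter y (z ∷ r))) (cong₂ _∷_ first (occ-rotAfter y (z ∷ r)))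
    where
    first : eq x y ∧ geq y (head (rotAfter y (z ∷ r))) ≡ geq x y ∧ eq y z
    first rewrite eq-ascent y≰x | geq-false y≰x = refl

  occ-rotRun : {n : ℕ} (s p x y : ℕ) (r : Vec ℕ n) → p ≡ y + s → y ≤ x →
    occ eq geq (p ∷ rotRun s y r) ≡ occ geq eq (x ∷ y ∷ r)
  occ-rotRun s p x y [] _ _ = refl
  occ-rotRun s p x y (z ∷ r) refl y≤x with z ≤? y
  ... | yes z≤y =
    trans (occ-cons eq geq p ((z + s) ∷ rotRun s z r))
      (cong₂ _∷_ first (occ-rotRun s (z + s) y z r refl z≤y))
    where
    first : eq (y + s) (z + s) ∧ geq (z + s) (head (rotRun s z r)) ≡ geq x y ∧ eq y z
    first rewrite eq-+ y z s | geq-true (rotRun-head s z r) | geq-true y≤x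
                | ∧-identityʳ (eq y z) = refl
  ... | no z≰y = cong₂ _∷_ first (occ-ascent r z≰y)
    where
    first : eq (y + s) y ∧ geq y z ≡ geq x y ∧ eq y z
    first rewrite geq-false z≰y | eq-ascent z≰y
                | ∧-zeroʳ (eq (y + s) y) | ∧-zeroʳ (geq x y) = refl

occ-rot : {n : ℕ} (e : Vec ℕ n) → occ eq geq (rot e) ≡ occ geq eq e
occ-rot [] = refl
occ-rot (x ∷ e) = occ-rotAfter x e

-- Rotating the drops of a run back needs its last drop: `lastDrop x v` is the
-- last drop of the run x ∷ v.  `unrotRun t p v` shifts the run v one step to
-- the right (p being the preceding entry) and subtracts t from every entry.

lastDrop : {n : ℕ} → ℕ → Vec ℕ (suc n) → ℕ
lastDrop x (y ∷ []) = x ∸ y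
lastDrop x (y ∷ z ∷ r) with z ≤? y
... | yes _ = lastDrop y (z ∷ r)
... | no _  = x ∸ y

mutual
  unrotAfter : {n : ℕ} → ℕ → Vec ℕ n → Vec ℕ n
  unrotAfter x [] = []
  unrotAfter x (y ∷ r) with y ≤? x
  ... | yes _ = unrotRun (lastDrop x (y ∷ r)) x (y ∷ r)
  ... | no _  = y ∷ unrotAfter y r

  unrotRun : {n : ℕ} → ℕ → ℕ → Vec ℕ (suc n) → Vec ℕ (suc n)
  unrotRun t p (o ∷ []) = (p ∸ t) ∷ []
  unrotRun t p (o ∷ c ∷ r) with c ≤? o
  ... | yes _ = (p ∸ t) ∷ unrotRun t o (c ∷ r)
  ... | no _  = (p ∸ t) ∷ c ∷ unrotAfter c r

lastDrop-asc : ∀ {k} w y z (r : Vec ℕ k) → ¬ z ≤ y → lastDrop w (y ∷ z ∷ r) ≡ w ∸ y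
lastDrop-asc w y z r z≰y with z ≤? y
... | yes z≤y = contradiction z≤y z≰y
... | no _    = refl

unrotAfter-asc : ∀ {k} x y (r : Vec ℕ k) → ¬ y ≤ x → unrotAfter x (y ∷ r) ≡ y ∷ unrotAfter y r
unrotAfter-asc x y r y≰x with y ≤? x
... | yes y≤x = contradiction y≤x y≰x
... | no _    = refl

unrotRun-asc : ∀ {k} t p y z (r : Vec ℕ k) → ¬ z ≤ y →
  unrotRun t p (y ∷ z ∷ r) ≡ (p ∸ t) ∷ z ∷ unrotAfter z r
unrotRun-asc t p y z r z≰y with z ≤? y
... | yes z≤y = contradiction z≤y z≰y
... | no _    = refl

lastDrop-desc : ∀ {k x} (v : Vec ℕ (suc k)) → head v ≤ x → ∀ w → lastDrop w (x ∷ v) ≡ lastDrop x v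
lastDrop-desc {x = x} (c ∷ _) desc w with c ≤? x
... | yes _  = refl
... | no c≰x = contradiction desc c≰x

unrotAfter-desc : ∀ {k x} (v : Vec ℕ (suc k)) → head v ≤ x → unrotAfter x v ≡ unrotRun (lastDrop x v) x v
unrotAfter-desc {x = x} (c ∷ _) desc with c ≤? x
... | yes _  = refl
... | no c≰x = contradiction desc c≰x

unrotRun-desc : ∀ {k x} (v : Vec ℕ (suc k)) → head v ≤ x → ∀ t p →
  unrotRun t p (x ∷ v) ≡ (p ∸ t) ∷ unrotRun t x v
unrotRun-desc {x = x} (c ∷ _) desc t p with c ≤? x
... | yes _  = refl
... | no c≰x = contradiction desc c≰x

lastDrop-rotRun : {n : ℕ} (s y : ℕ) (r : Vec ℕ n) → lastDrop (y + s) (rotRun s y r) ≡ s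
lastDrop-rotRun s y [] = m+n∸m≡n y s
lastDrop-rotRun s y (z ∷ r) with z ≤? y
... | yes _ = trans (lastDrop-desc (rotRun s z r) (rotRun-head s z r) (y + s)) (lastDrop-rotRun s z r)
... | no z≰y = trans (lastDrop-asc (y + s) y z (rotAfter z r) z≰y) (m+n∸m≡n y s)

mutual
  unrotAfter-rotAfter : {n : ℕ} (x : ℕ) (r : Vec ℕ n) → unrotAfter x (rotAfter x r) ≡ r
  unrotAfter-rotAfter x [] = refl
  unrotAfter-rotAfter x (y ∷ r) with y ≤? x
  ... | yes y≤x = begin
      unrotAfter x (rotRun s y r)
        ≡⟨ unrotAfter-desc (rotRun s y r) (subst (head (rotRun s y r) ≤_) y+s≡x (rotRun-head s y r)) ⟩
      unrotRun (lastDrop x (rotRun s y r)) x (rotRun s y r)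
        ≡⟨ cong (λ t → unrotRun t x (rotRun s y r)) (subst (λ w → lastDrop w (rotRun s y r) ≡ s) y+s≡x (lastDrop-rotRun s y r)) ⟩
      unrotRun s x (rotRun s y r)
        ≡⟨ unrotRun-rotRun s x y r (sym y+s≡x) ⟩
      y ∷ r ∎
    where
    s = x ∸ y
    y+s≡x = m+[n∸m]≡n y≤x
  ... | no y≰x = trans (unrotAfter-asc x y (rotAfter y r) y≰x) (cong (y ∷_) (unrotAfter-rotAfter y r))

  unrotRun-rotRun : {n : ℕ} (s p y : ℕ) (r : Vec ℕ n) → p ≡ y + s →
    unrotRun s p (rotRun s y r) ≡ y ∷ r
  unrotRun-rotRun s p y [] refl = cong (_∷ []) (m+n∸n≡m y s)
  unrotRun-rotRun s p y (z ∷ r) refl with z ≤? y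
  ... | yes _ = trans (unrotRun-desc (rotRun s z r) (rotRun-head s z r) s p)
                      (cong₂ _∷_ (m+n∸n≡m y s) (unrotRun-rotRun s (z + s) z r refl))
  ... | no z≰y = trans (unrotRun-asc s (y + s) y z (rotAfter z r) z≰y)
                       (cong₂ _∷_ (m+n∸n≡m y s) (cong (z ∷_) (unrotAfter-rotAfter z r)))

rot-injective : {n : ℕ} {a b : Vec ℕ n} → rot a ≡ rot b → a ≡ b
rot-injective {a = []} {[]} _ = refl
rot-injective {a = x ∷ a} {y ∷ b} e = cong₂ _∷_ (cong head e) (begin
  a                           ≡⟨ sym (unrotAfter-rotAfter x a) ⟩
  unrotAfter x (rotAfter x a) ≡⟨ cong₂ unrotAfter (cong head e) (cong tail e) ⟩
  unrotAfter y (rotAfter y b) ≡⟨ unrotAfter-rotAfter y b ⟩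
  b                           ∎)

-- `Bounded k e` says that the i-th entry of e (counting from 0) is below k + i;
-- the inversion sequences of length n are the sequences with `Bounded 1`.

Bounded : {n : ℕ} → ℕ → Vec ℕ n → Set
Bounded k [] = ⊤
Bounded k (x ∷ xs) = x < k × Bounded (suc k) xs

-- `rot` keeps every entry below the first entry of its run.
mutual
  rotAfter-bounded : {n : ℕ} (k x : ℕ) (r : Vec ℕ n) → x < k →
    Bounded (suc k) r → Bounded (suc k) (rotAfter x r)
  rotAfter-bounded k x [] _ _ = tt
  rotAfter-bounded k x (y ∷ r) x<k (y<1+k , r-bd) with y ≤? x
  ... | yes y≤x = rotRun-bounded (suc k) (x ∸ y) y r (y<1+k , r-bd)
                    (subst (_< suc k) (sym (m+[n∸m]≡n y≤x)) (m<n⇒m<1+n x<k))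
  ... | no _    = y<1+k , rotAfter-bounded (suc k) y r y<1+k r-bd

  rotRun-bounded : {n : ℕ} (k s y : ℕ) (r : Vec ℕ n) → Bounded k (y ∷ r) → y + s < k →
    Bounded k (rotRun s y r)
  rotRun-bounded k s y [] bd _ = bd
  rotRun-bounded k s y (z ∷ r) (y<k , z<1+k , r-bd) y+s<k with z ≤? y
  ... | yes z≤y = z+s<k , rotRun-bounded (suc k) s z r (z<1+k , r-bd) (m<n⇒m<1+n z+s<k)
    where z+s<k = ≤-<-trans (+-monoˡ-≤ s z≤y) y+s<k
  ... | no _    = y<k , z<1+k , rotAfter-bounded (suc k) z r z<1+k r-bd

rot-bounded : {n : ℕ} (e : Vec ℕ n) → Bounded 1 e → Bounded 1 (rot e)
rot-bounded [] bd = bd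
rot-bounded (x ∷ e) (x<1 , e-bd) = x<1 , rotAfter-bounded 1 x e x<1 e-bd

bounded-∷ʳ : {n : ℕ} (k : ℕ) (xs : Vec ℕ n) (y : ℕ) →
  Bounded k (xs ∷ʳ y) ⇔ (Bounded k xs × y < k + n)
bounded-∷ʳ {zero} k [] y = mk⇔
  (λ (y<k , _) → tt , subst (y <_) (sym (+-identityʳ k)) y<k)
  (λ (_ , y<k+0) → subst (y <_) (+-identityʳ k) y<k+0 , tt)
bounded-∷ʳ {suc n} k (x ∷ xs) y = mk⇔
  (λ (x<k , bd) → let (xs-bd , y<) = Equivalence.to ih bd in (x<k , xs-bd) , subst (y <_) (sym (+-suc k n)) y<)
  (λ ((x<k , xs-bd) , y<) → x<k , Equivalence.from ih (xs-bd , subst (y <_) (+-suc k n) y<))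
  where ih = bounded-∷ʳ (suc k) xs y

invSeqs-complete : (n : ℕ) (e : Vec ℕ n) → Bounded 1 e → e ∈ invSeqs n
invSeqs-complete zero [] _ = here refl
invSeqs-complete (suc n) e bd with initLast e
... | ys , y , refl =
  let (ys-bd , y<) = Equivalence.to (bounded-∷ʳ 1 ys y) bd in
  ∈-concatMap⁺ (λ e' → map (e' ∷ʳ_) (upTo (suc n)))
    (lose (invSeqs-complete n ys ys-bd) (∈-map⁺ (ys ∷ʳ_) (∈-upTo⁺ y<)))

invSeqs-sound : (n : ℕ) {e : Vec ℕ n} → e ∈ invSeqs n → Bounded 1 e
invSeqs-sound zero {[]} _ = tt
invSeqs-sound (suc n) e∈
  with ys , ys∈ , e∈map ← find (∈-concatMap⁻ (λ e' → map (e' ∷ʳ_) (upTo (suc n))) {xs = invSeqs n} e∈)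
  with y , y∈ , refl ← ∈-map⁻ (ys ∷ʳ_) e∈map
  = Equivalence.from (bounded-∷ʳ 1 ys y) (invSeqs-sound n ys∈ , ∈-upTo⁻ y∈)

concatMap-map : {A B C : Set} (g : A → B → C) (xs : List A) (ys : List B) →
  concatMap (λ x → map (g x) ys) xs ≡ cartesianProductWith g xs ys
concatMap-map g [] ys = refl
concatMap-map g (x ∷ xs) ys = cong (map (g x) ys ++_) (concatMap-map g xs ys)

invSeqs-unique : (n : ℕ) → Unique (invSeqs n)
invSeqs-unique zero = All.[] ∷ []
invSeqs-unique (suc n) =
  subst Unique (sym (concatMap-map _∷ʳ_ (invSeqs n) (upTo (suc n))))
    (Unique.cartesianProductWith⁺ _∷ʳ_ (λ {w} {x} → ∷ʳ-injective w x) (invSeqs-unique n) (Unique.upTo⁺ (suc n)))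

rot-invSeqs : (n : ℕ) {e : Vec ℕ n} → e ∈ invSeqs n → rot e ∈ invSeqs n
rot-invSeqs n {e} e∈ = invSeqs-complete n (rot e) (rot-bounded e (invSeqs-sound n e∈))

module _ {A : Set} where

  unique-⊆-length : (xs ys : List A) → Unique xs → (∀ {z} → z ∈ xs → z ∈ ys) →
    length xs ≤ length ys
  unique-⊆-length [] ys _ _ = z≤n
  unique-⊆-length (x ∷ xs) ys (x∉xs ∷ xs-uniq) xs⊆ys with ∈-∃++ (xs⊆ys (here refl))
  ... | as , bs , refl =
    subst (suc (length xs) ≤_) (sym (length-++-sucʳ as x bs))
      (s≤s (unique-⊆-length xs (as ++ bs) xs-uniq xs⊆as++bs))
    where
    xs⊆as++bs : ∀ {z} → z ∈ xs → z ∈ as ++ bs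
    xs⊆as++bs {z} z∈xs with ∈-++⁻ as (xs⊆ys (there z∈xs))
    ... | inj₁ z∈as          = ∈-++⁺ˡ z∈as
    ... | inj₂ (here refl)   = contradiction refl (All.lookup x∉xs z∈xs)
    ... | inj₂ (there z∈bs) = ∈-++⁺ʳ as z∈bs

  filter-length-split : {P : A → Set} (P? : Decidable P) (xs : List A) →
    length (filter P? xs) + length (filter (¬? ∘ P?) xs) ≡ length xs
  filter-length-split P? [] = refl
  filter-length-split P? (x ∷ xs) with P? x
  ... | yes _ = cong suc (filter-length-split P? xs)
  ... | no _  = trans (+-suc _ _) (cong suc (filter-length-split P? xs))

  count-≤ : {P Q : A → Set} (P? : Decidable P) (Q? : Decidable Q) (f : A → A) (L : List A) →
    Unique L → (∀ {x y} → f x ≡ f y → x ≡ y) → (∀ {x} → x ∈ L → f x ∈ L) →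
    (∀ {x} → P x → Q (f x)) → length (filter P? L) ≤ length (filter Q? L)
  count-≤ P? Q? f L L-uniq f-inj f-closed P⇒Q =
    subst (_≤ length (filter Q? L)) (length-map f (filter P? L))
      (unique-⊆-length (map f (filter P? L)) (filter Q? L) (Unique.map⁺ f-inj (Unique.filter⁺ P? L-uniq)) image⊆)
    where
    image⊆ : ∀ {z} → z ∈ map f (filter P? L) → z ∈ filter Q? L
    image⊆ z∈ with x , x∈ , refl ← ∈-map⁻ f z∈ with x∈L , Px ← ∈-filter⁻ P? x∈ =
      ∈-filter⁺ Q? (f-closed x∈L) (P⇒Q Px)

  count-≡ : {P Q : A → Set} (P? : Decidable P) (Q? : Decidable Q) (f : A → A) (L : List A) →
    Unique L → (∀ {x y} → f x ≡ f y → x ≡ y) → (∀ {x} → x ∈ L → f x ∈ L) →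
    (∀ {x} → P x ⇔ Q (f x)) → length (filter P? L) ≡ length (filter Q? L)
  count-≡ P? Q? f L L-uniq f-inj f-closed P⇔Q =
    +-cancelʳ-≤-squeeze
      (count-≤ P? Q? f L L-uniq f-inj f-closed (Equivalence.to P⇔Q))
      (count-≤ (¬? ∘ P?) (¬? ∘ Q?) f L L-uniq f-inj f-closed (λ ¬P Q → ¬P (Equivalence.from P⇔Q Q)))
      (trans (filter-length-split P? L) (sym (filter-length-split Q? L)))
    where
    +-cancelʳ-≤-squeeze : ∀ {a b a' b'} → a ≤ b → a' ≤ b' → a + a' ≡ b + b' → a ≡ b
    +-cancelʳ-≤-squeeze a≤b a'≤b' e =
      ≤-antisym a≤b (≮⇒≥ λ a<b → <-irrefl e (+-mono-<-≤ a<b a'≤b'))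

proposition3p3 : (n : ℕ) → n ≥ 1 → (S : Subset n) →
    count geq eq n S ≡ count eq geq n S
proposition3p3 n _ S =
  count-≡ (occurs-as geq eq) (occurs-as eq geq) rot (invSeqs n)
    (invSeqs-unique n) rot-injective (rot-invSeqs n) (λ {e} → occ-transfer e)
  where
  occurs-as : (R₁ R₂ : ℕ → ℕ → Bool) (e : Vec ℕ n) → Dec (occ R₁ R₂ e ≡ S)
  occurs-as R₁ R₂ e = VecP.≡-dec BoolP._≟_ (occ R₁ R₂ e) S

  occ-transfer : ∀ e → occ geq eq e ≡ S ⇔ occ eq geq (rot e) ≡ S
  occ-transfer e = mk⇔ (trans (occ-rot e)) (trans (sym (occ-rot e)))
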